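{- For any $n\ge4$, the bond lattice $L(C_n)$ of the cycle graph $C_n$ is not isomorphic to the core of any upho lattice.
   Context: $C_n$ is the graph on $\{1,\ldots,n\}$ with edges $\{1,2\},\{2,3\},\ldots,\{n-1,n\},\{n,1\}$. For a connected simple graph $G$ on $[n]$, a set partition of $[n]$ is $G$-connected if the induced subgraph on each block is connected; the bond lattice $L(G)$ is the set of $G$-connected partitions ordered by refinement. A poset $\mathcal{P}$ is finite type $\mathbb{N}$-graded if it has a minimum $\hat0$, a rank function $\rho$ with $\rho(\hat0)=0$ such that every maximal chain has the form $\hat0=x_0\lessdot x_1\lessdot\cdots$ with $\rho(x_i)=i$, and finitely many elements of each rank. An upho lattice is a finite type $\mathbb{N}$-graded lattice $\mathcal{L}$ with at least two elements such that every principal filter $\{q\ge p\}$ is isomorphic to $\mathcal{L}$. Its core is $[\hat0,s_1\vee\cdots\vee s_r]$ with $s_i$ the atoms of $\mathcal{L}$. -}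

module Defs where

open import Level using (Level; _⊔_; 0ℓ) renaming (suc to lsuc)
open import Data.Nat using (ℕ; zero; suc; _<_)
open import Data.Fin using (Fin; toℕ)
open import Data.Bool using (Bool; true; false; T)
open import Data.Unit using (tt)
open import Data.Empty using (⊥-elim)
open import Data.Product using (Σ; ∃; ∃₂; _×_; _,_; proj₁; proj₂)
open import Data.Sum using (_⊎_)
open import Data.List using (List)
open import Data.List.Relation.Unary.Any using (Any)
open import Relation.Nullary using (¬_)
open import Relation.Unary using (Pred)
open import Relation.Binary.PropositionalEquality as ≡ using (_≡_; refl)
open import Relation.Binary.Bundles using (Poset)
open import Relation.Binary.Structures using (IsPartialOrder; IsPreorder; IsEquivalence)
open import Relation.Binary.Lattice.Bundles using (Lattice)

record OrderIso {a b c d e f : Level} (P : Poset a b c) (Q : Poset d e f)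
       : Set (a ⊔ b ⊔ c ⊔ d ⊔ e ⊔ f) where
  private
    module P = Poset P
    module Q = Poset Q
  field
    to       : P.Carrier → Q.Carrier
    from     : Q.Carrier → P.Carrier
    to-cong  : ∀ {x y} → x P.≈ y → to x Q.≈ to y
    from-cong : ∀ {x y} → x Q.≈ y → from x P.≈ from y
    to-mono  : ∀ {x y} → x P.≤ y → to x Q.≤ to y
    from-mono : ∀ {x y} → x Q.≤ y → from x P.≤ from y
    from∘to  : ∀ x → from (to x) P.≈ x
    to∘from  : ∀ y → to (from y) Q.≈ y

SubPoset : {a b c p : Level} (P : Poset a b c) → Pred (Poset.Carrier P) p →
           Poset (a ⊔ p) b c
SubPoset P S = record
  { Carrier = Σ Carrier S
  ; _≈_ = λ x y → proj₁ x ≈ proj₁ y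
  ; _≤_ = λ x y → proj₁ x ≤ proj₁ y
  ; isPartialOrder = record
    { isPreorder = record
      { isEquivalence = record
        { refl = Eq.refl ; sym = Eq.sym ; trans = Eq.trans }
      ; reflexive = reflexive
      ; trans = trans
      }
    ; antisym = antisym
    }
  }
  where open Poset P

module _ {c ℓ₁ ℓ₂ : Level} (L : Lattice c ℓ₁ ℓ₂) where
  open Lattice L

  _<ᴸ_ : Carrier → Carrier → Set (ℓ₁ ⊔ ℓ₂)
  x <ᴸ y = x ≤ y × ¬ (x ≈ y)

  _⋖_ : Carrier → Carrier → Set (c ⊔ ℓ₁ ⊔ ℓ₂)
  x ⋖ y = x <ᴸ y × (∀ z → ¬ (x <ᴸ z × z <ᴸ y))

  Filter : Carrier → Poset (c ⊔ ℓ₂) ℓ₁ ℓ₂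
  Filter p = SubPoset poset (λ q → p ≤ q)

  Interval : Carrier → Carrier → Poset (c ⊔ ℓ₂) ℓ₁ ℓ₂
  Interval b t = SubPoset poset (λ x → b ≤ x × x ≤ t)

-- Upho lattices.
-- "finite type ℕ-graded" is rendered as: a minimum ⊥̂, a rank function
-- ρ (respecting equality) with ρ ⊥̂ = 0, ρ y = ρ x + 1 whenever x ⋖ y,
-- x < y ⇒ ρ x < ρ y, and finitely many elements of each rank.

record UphoLattice (c ℓ₁ ℓ₂ : Level) : Set (lsuc (c ⊔ ℓ₁ ⊔ ℓ₂)) where
  field
    lattice : Lattice c ℓ₁ ℓ₂
  open Lattice lattice
  field
    ⊥̂          : Carrier
    minimum    : ∀ x → ⊥̂ ≤ x
    ρ          : Carrier → ℕ
    ρ-cong     : ∀ {x y} → x ≈ y → ρ x ≡ ρ y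
    ρ-⊥̂        : ρ ⊥̂ ≡ 0
    ρ-cover    : ∀ x y → _⋖_ lattice x y → ρ y ≡ suc (ρ x)
    ρ-strict   : ∀ x y → _<ᴸ_ lattice x y → ρ x < ρ y
    finiteRank : ∀ k → ∃ λ (xs : List Carrier) → ∀ x → ρ x ≡ k → Any (x ≈_) xs
    nontrivial : ∃₂ λ x y → ¬ (x ≈ y)
    upho       : ∀ p → OrderIso (Filter lattice p) poset

  IsJoinOfAtoms : Carrier → Set (c ⊔ ℓ₁ ⊔ ℓ₂)
  IsJoinOfAtoms t =
    (∀ s → _⋖_ lattice ⊥̂ s → s ≤ t) ×
    (∀ u → (∀ s → _⋖_ lattice ⊥̂ s → s ≤ u) → t ≤ u)

  Core : Carrier → Poset (c ⊔ ℓ₂) ℓ₁ ℓ₂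
  Core t = Interval lattice ⊥̂ t

-- The cycle graph C_n on vertex set Fin n (vertex i ↔ i+1 ∈ [n]).

Adj : (n : ℕ) → Fin n → Fin n → Set
Adj n i j =
  (suc (toℕ i) ≡ toℕ j) ⊎ (suc (toℕ j) ≡ toℕ i) ⊎
  ((toℕ i ≡ 0 × suc (toℕ j) ≡ n) ⊎ (toℕ j ≡ 0 × suc (toℕ i) ≡ n))

data Walk {n : ℕ} (P : Fin n → Set) : Fin n → Fin n → Set where
  here : ∀ {i} → P i → Walk P i i
  step : ∀ {i j k} → P i → Adj n i j → Walk P j k → Walk P i k

-- A set partition of Fin n, given by its (decidable) equivalence
-- relation "in the same block", whose blocks induce connected subgraphs
-- of C_n.
record CnConnectedPartition (n : ℕ) : Set where
  field
    same      : Fin n → Fin n → Bool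
    same-refl : ∀ i → T (same i i)
    same-sym  : ∀ i j → T (same i j) → T (same j i)
    same-trans : ∀ i j k → T (same i j) → T (same j k) → T (same i k)
    connected : ∀ i j → T (same i j) → Walk (λ k → T (same i k)) i j
open CnConnectedPartition

private
  T-ext : ∀ {a b : Bool} → (T a → T b) → (T b → T a) → a ≡ b
  T-ext {false} {false} f g = refl
  T-ext {false} {true}  f g = ⊥-elim (g tt)
  T-ext {true}  {false} f g = ⊥-elim (f tt)
  T-ext {true}  {true}  f g = refl

BondLatticeCycle : ℕ → Poset 0ℓ 0ℓ 0ℓ
BondLatticeCycle n = record
  { Carrier = CnConnectedPartition n
  ; _≈_ = λ π σ → ∀ i j → same π i j ≡ same σ i j
  ; _≤_ = λ π σ → ∀ i j → T (same π i j) → T (same σ i j)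
  ; isPartialOrder = record
    { isPreorder = record
      { isEquivalence = record
        { refl = λ i j → refl
        ; sym = λ e i j → ≡.sym (e i j)
        ; trans = λ e f i j → ≡.trans (e i j) (f i j) }
      ; reflexive = λ e i j p → ≡.subst T (e i j) p
      ; trans = λ f g i j p → g i j (f i j p)
      }
    ; antisym = λ f g i j → T-ext (f i j) (g i j)
    }
  }

{-# OPTIONS --safe #-}
module Submission where

-- Let a be an atom of the core [⊥̂, t] and φ : [a, ∞) ≅ L the upho isomorphism at a. The upper
-- covers of a inside the core are sent by φ to distinct atoms of L lying below φ(t) ∧ t. In L(C_n),
-- n ≥ 4, the atom joining the edge {n, 1} has n - 1 distinct upper covers, while any n - 1 distinct
-- atoms (edges) already connect the whole cycle; transported through the core this forces t ≤ φ(t).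
-- Then φ⁻¹ maps [⊥̂, t] into itself and moves ⊥̂ strictly up, so the iterates of φ⁻¹ on ⊥̂ form an
-- infinite strictly increasing chain below t, which the rank function forbids.

open import Level using (Level; 0ℓ)
open import Data.Nat as ℕ using (ℕ; zero; suc; z≤n; s≤s)
import Data.Nat.Properties as ℕ
open import Data.Fin as Fin using (Fin; zero; suc; toℕ; fromℕ; inject₁; punchOut)
import Data.Fin.Properties as Fin
open import Data.Fin.Induction using (<-weakInduction; >-weakInduction)
open import Data.Fin.Relation.Unary.Top using (View; ‵fromℕ; ‵inject₁; view; view-fromℕ; view-inject₁)
open import Data.Bool using (T)
import Data.Bool.Properties as Bool
open import Data.Empty using (⊥; ⊥-elim)
open import Data.Product using (∃; _×_; _,_; proj₁; proj₂)
open import Data.Sum using (_⊎_; inj₁; inj₂; fromInj₁)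
open import Function.Base using (_∘_)
open import Function.Definitions using (Injective)
open import Relation.Nullary using (¬_; ¬?; Dec; yes; no)
open import Relation.Nullary.Decidable
  using (decidable-stable; ⌊_⌋; toWitness; fromWitness; T?; _⊎-dec_; _×-dec_)
open import Relation.Unary using (Pred)
open import Relation.Binary.Core using (Rel)
open import Relation.Binary.Definitions using (Decidable)
open import Relation.Binary.Bundles using (Poset)
open import Relation.Binary.Structures using (IsEquivalence)
open import Relation.Binary.Lattice.Bundles using (Lattice)
open import Relation.Binary.PropositionalEquality as ≡ using (_≡_; _≢_; refl)
import Relation.Binary.Properties.Poset as PosetProperties
import Relation.Binary.Reasoning.PartialOrder as ≤-Reasoning

open import Defs

open CnConnectedPartition

private
  variable
    c₁ c₂ ℓ₁ ℓ₂ ℓ₃ ℓ₄ ℓ : Level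

Covers : (P : Poset c₁ ℓ₁ ℓ₂) → Poset.Carrier P → Poset.Carrier P → Set _
Covers P x y = x < y × (∀ z → ¬ (x < z × z < y))
  where open PosetProperties P using (_<_)

-- For a lattice L, x ⋖[ Lattice.poset L ] y unfolds to the covering relation _⋖_ L x y of Defs.
syntax Covers P x y = x ⋖[ P ] y

module _ (P : Poset c₁ ℓ₁ ℓ₂) where
  open Poset P
  open PosetProperties P using (<-respˡ-≈)

  ⋖-respˡ-≈ : ∀ {x x′ y} → x ≈ x′ → x ⋖[ P ] y → x′ ⋖[ P ] y
  ⋖-respˡ-≈ x≈x′ (x<y , nothing-between) =
    <-respˡ-≈ x≈x′ x<y , λ z (x′<z , z<y) → nothing-between z (<-respˡ-≈ (Eq.sym x≈x′) x′<z , z<y)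

  module _ (S : Pred Carrier ℓ) where

    ⋖-restrict : ∀ {x y} {Sx : S x} {Sy : S y} → x ⋖[ P ] y → (x , Sx) ⋖[ SubPoset P S ] (y , Sy)
    ⋖-restrict (x<y , nothing-between) = x<y , λ z → nothing-between (proj₁ z)

    ⋖-extend : (∀ {x y z} → S x → S y → x ≤ z → z ≤ y → S z) →
               ∀ {x y} → x ⋖[ SubPoset P S ] y → proj₁ x ⋖[ P ] proj₁ y
    ⋖-extend convex {_ , Sx} {_ , Sy} (x<y , nothing-between) = x<y , λ z (x<z , z<y) →
      nothing-between (z , convex Sx Sy (proj₁ x<z) (proj₁ z<y)) (x<z , z<y)

OrderIso-sym : {P : Poset c₁ ℓ₁ ℓ₂} {Q : Poset c₂ ℓ₃ ℓ₄} → OrderIso P Q → OrderIso Q P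
OrderIso-sym I = record
  { to = from ; from = to ; to-cong = from-cong ; from-cong = to-cong
  ; to-mono = from-mono ; from-mono = to-mono ; from∘to = to∘from ; to∘from = from∘to
  }
  where open OrderIso I

module _ {P : Poset c₁ ℓ₁ ℓ₂} {Q : Poset c₂ ℓ₃ ℓ₄} (I : OrderIso P Q) where
  private
    module P = Poset P
    module Q = Poset Q
  open OrderIso I
  open PosetProperties P using () renaming (_<_ to _<ᴾ_)
  open PosetProperties Q using () renaming (_<_ to _<ᵠ_)

  to-reflects-≤ : ∀ {x y} → to x Q.≤ to y → x P.≤ y
  to-reflects-≤ {x} {y} tx≤ty = begin
    x            ≈⟨ P.Eq.sym (from∘to x) ⟩
    from (to x)  ≤⟨ from-mono tx≤ty ⟩
    from (to y)  ≈⟨ from∘to y ⟩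
    y            ∎
    where open ≤-Reasoning P

  to-injective : Injective P._≈_ Q._≈_ to
  to-injective {x} {y} tx≈ty =
    P.Eq.trans (P.Eq.sym (from∘to x)) (P.Eq.trans (from-cong tx≈ty) (from∘to y))

  to-< : ∀ {x y} → x <ᴾ y → to x <ᵠ to y
  to-< (x≤y , x≉y) = to-mono x≤y , x≉y ∘ to-injective

module _ {P : Poset c₁ ℓ₁ ℓ₂} {Q : Poset c₂ ℓ₃ ℓ₄} (I : OrderIso P Q) where
  open OrderIso I
  open PosetProperties P using (<-respˡ-≈; <-respʳ-≈)

  to-⋖ : ∀ {x y} → x ⋖[ P ] y → to x ⋖[ Q ] to y
  to-⋖ {x} {y} (x<y , nothing-between) = to-< I x<y , λ z (tx<z , z<ty) →
    nothing-between (from z) ( <-respˡ-≈ (from∘to x) (to-< (OrderIso-sym I) tx<z)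
                             , <-respʳ-≈ (from∘to y) (to-< (OrderIso-sym I) z<ty))

module _ (U : UphoLattice c₁ ℓ₁ ℓ₂) where
  open UphoLattice U
  open Lattice lattice renaming (refl to ≤-refl)
  open PosetProperties poset using (_<_; ≤∧≉⇒<)

  strict-chain-unbounded : (g : ℕ → Carrier) → (∀ j → g j < g (suc j)) → ∀ u → ¬ (∀ j → g j ≤ u)
  strict-chain-unbounded g g↑ u g≤u = ℕ.<-asym (j≤ρ (suc (ρ u))) (ρ-strict _ _ g<u)
    where
      j≤ρ : ∀ j → j ℕ.≤ ρ (g j)
      j≤ρ zero    = z≤n
      j≤ρ (suc j) = ℕ.≤-trans (s≤s (j≤ρ j)) (ρ-strict _ _ (g↑ j))
      g<u : g (suc (ρ u)) < u
      g<u = begin-strict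
        g (suc (ρ u))        <⟨ g↑ _ ⟩
        g (suc (suc (ρ u)))  ≤⟨ g≤u _ ⟩
        u                    ∎
        where open ≤-Reasoning poset

  module _ {p : Carrier} where
    open OrderIso (upho p)

    upho-base : to (p , ≤-refl) ≈ ⊥̂
    upho-base = antisym (begin
      to (p , ≤-refl)  ≤⟨ to-mono (proj₂ (from ⊥̂)) ⟩
      to (from ⊥̂)      ≈⟨ to∘from ⊥̂ ⟩
      ⊥̂                ∎) (minimum _)
      where open ≤-Reasoning poset

    cover⇒upho-atom : ∀ {q} (p≤q : p ≤ q) → _⋖_ lattice p q → _⋖_ lattice ⊥̂ (to (q , p≤q))
    cover⇒upho-atom p≤q p⋖q =
      ⋖-respˡ-≈ poset upho-base (to-⋖ (upho p) (⋖-restrict poset (p ≤_) {Sx = ≤-refl} {Sy = p≤q} p⋖q))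

    ≰-upho-image : ∀ {t} (p≤t : p ≤ t) → ¬ p ≈ ⊥̂ → ¬ t ≤ to (t , p≤t)
    ≰-upho-image {t} p≤t p≉⊥̂ t≤φt = strict-chain-unbounded chain chain↑ t chain≤t
      where
        φ⁻¹ : Carrier → Carrier
        φ⁻¹ x = proj₁ (from x)
        φ⁻¹-≤t : ∀ {x} → x ≤ t → φ⁻¹ x ≤ t
        φ⁻¹-≤t {x} x≤t = begin
          φ⁻¹ x               ≤⟨ from-mono (trans x≤t t≤φt) ⟩
          φ⁻¹ (to (t , p≤t))  ≈⟨ from∘to (t , p≤t) ⟩
          t                   ∎
          where open ≤-Reasoning poset
        ⊥̂<φ⁻¹⊥̂ : ⊥̂ < φ⁻¹ ⊥̂
        ⊥̂<φ⁻¹⊥̂ = ≤∧≉⇒< (minimum _) λ ⊥̂≈φ⁻¹⊥̂ →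
          p≉⊥̂ (antisym (trans (proj₂ (from ⊥̂)) (reflexive (Eq.sym ⊥̂≈φ⁻¹⊥̂))) (minimum p))
        chain : ℕ → Carrier
        chain zero    = ⊥̂
        chain (suc j) = φ⁻¹ (chain j)
        chain↑ : ∀ j → chain j < chain (suc j)
        chain↑ zero    = ⊥̂<φ⁻¹⊥̂
        chain↑ (suc j) = to-< (OrderIso-sym (upho p)) (chain↑ j)
        chain≤t : ∀ j → chain j ≤ t
        chain≤t zero    = minimum t
        chain≤t (suc j) = φ⁻¹-≤t (chain≤t j)

AtomsForceTop : (P : Poset c₁ ℓ₁ ℓ₂) → Set ℓ → Poset.Carrier P → Set _
AtomsForceTop P I ⊥P = ∀ (C : I → Carrier) → (∀ i → ⊥P ⋖[ P ] C i) → Injective _≡_ _≈_ C →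
                       ∀ {W} → (∀ i → C i ≤ W) → ∀ X → X ≤ W
  where open Poset P

module _ (U : UphoLattice c₁ ℓ₁ ℓ₂) where
  open UphoLattice U
  open Lattice lattice renaming (refl to ≤-refl)

  module _ {t : Carrier} (atoms≤t : ∀ s → _⋖_ lattice ⊥̂ s → s ≤ t)
           {P : Poset c₂ ℓ₃ ℓ₄} (ψ : OrderIso P (Core t)) where
    private
      module P = Poset P
      ψ⁻¹ = OrderIso-sym ψ
    open OrderIso ψ

    core-convex : ∀ {x y z} → ⊥̂ ≤ x × x ≤ t → ⊥̂ ≤ y × y ≤ t → x ≤ z → z ≤ y → ⊥̂ ≤ z × z ≤ t
    core-convex _ (_ , y≤t) _ z≤y = minimum _ , trans z≤y y≤t

    core-has-no-forcing-covers : ∀ {I : Set ℓ} (⊥P : P.Carrier) → (∀ X → ⊥P P.≤ X) →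
      (A : P.Carrier) → ¬ A P.≤ ⊥P →
      (B : I → P.Carrier) → (∀ i → A ⋖[ P ] B i) → Injective _≡_ P._≈_ B →
      AtomsForceTop P I ⊥P → ⊥
    core-has-no-forcing-covers {I = I} ⊥P ⊥P-least A A≰⊥P B A⋖B B-injective atoms-force-top =
      ≰-upho-image U a≤t a≉⊥̂ t≤φt
      where
        a : Carrier
        a = proj₁ (to A)
        a≤t : a ≤ t
        a≤t = proj₂ (proj₂ (to A))
        module φ = OrderIso (upho a)
        a≉⊥̂ : ¬ a ≈ ⊥̂
        a≉⊥̂ a≈⊥̂ = A≰⊥P (to-reflects-≤ ψ (trans (reflexive a≈⊥̂) (minimum _)))
        b : I → Carrier
        b i = proj₁ (to (B i))
        a⋖b : ∀ i → a ⋖[ poset ] b i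
        a⋖b i = ⋖-extend poset _ core-convex {to A} {to (B i)} (to-⋖ ψ (A⋖B i))
        c : I → Carrier
        c i = φ.to (b i , proj₁ (proj₁ (a⋖b i)))
        c-atom : ∀ i → _⋖_ lattice ⊥̂ (c i)
        c-atom i = cover⇒upho-atom U _ (a⋖b i)
        c≤t : ∀ i → c i ≤ t
        c≤t i = atoms≤t _ (c-atom i)
        C : I → P.Carrier
        C i = from (c i , minimum _ , c≤t i)
        ψ⁻¹⊥̂≈⊥P : from (⊥̂ , ≤-refl , minimum t) P.≈ ⊥P
        ψ⁻¹⊥̂≈⊥P = P.antisym (P.trans (from-mono (minimum _)) (P.reflexive (from∘to ⊥P))) (⊥P-least _)
        C-atom : ∀ i → ⊥P ⋖[ P ] C i
        C-atom i = ⋖-respˡ-≈ P ψ⁻¹⊥̂≈⊥P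
          (to-⋖ ψ⁻¹ (⋖-restrict poset _ {Sx = ≤-refl , minimum t} {Sy = minimum _ , c≤t i} (c-atom i)))
        C-injective : Injective _≡_ P._≈_ C
        C-injective Ci≈Cj = B-injective (to-injective ψ (to-injective (upho a) (to-injective ψ⁻¹ Ci≈Cj)))
        w : Carrier
        w = φ.to (t , a≤t) ∧ t
        C≤W : ∀ i → C i P.≤ from (w , minimum w , x∧y≤y _ _)
        C≤W i = from-mono (∧-greatest (φ.to-mono (proj₂ (proj₂ (to (B i))))) (c≤t i))
        t≤w : t ≤ w
        t≤w = to-reflects-≤ ψ⁻¹ (atoms-force-top C C-atom C-injective C≤W (from (t , minimum t , ≤-refl)))
        t≤φt : t ≤ φ.to (t , a≤t)
        t≤φt = trans t≤w (x∧y≤x _ _)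

injective-misses-two : ∀ {m} {f : Fin m → Fin (suc m)} → Injective _≡_ _≡_ f →
                       ∀ {x y} → x ≢ y → (∀ i → f i ≢ x) → (∀ i → f i ≢ y) → ⊥
injective-misses-two {zero} _ {zero} {zero} x≢y _ _ = x≢y refl
injective-misses-two {suc m} {f} f-injective {x} {y} x≢y x-missed y-missed =
  ℕ.1+n≰n (Fin.injective⇒≤ h-injective)
  where
    y≢f : ∀ i → y ≢ f i
    y≢f i = y-missed i ∘ ≡.sym
    y≢x : y ≢ x
    y≢x = x≢y ∘ ≡.sym
    g : Fin (suc m) → Fin (suc m)
    g i = punchOut (y≢f i)
    x′ : Fin (suc m)
    x′ = punchOut y≢x
    x′≢g : ∀ i → x′ ≢ g i
    x′≢g i x′≡gi = x-missed i (≡.sym (Fin.punchOut-injective y≢x (y≢f i) x′≡gi))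
    h : Fin (suc m) → Fin m
    h i = punchOut (x′≢g i)
    h-injective : Injective _≡_ _≡_ h
    h-injective {i} {j} hi≡hj =
      f-injective (Fin.punchOut-injective (y≢f i) (y≢f j)
                    (Fin.punchOut-injective (x′≢g i) (x′≢g j) hi≡hj))

injective-misses-one : ∀ {m} (f : Fin m → Fin (suc m)) → Injective _≡_ _≡_ f →
                       ∃ λ j → ∀ x → x ≢ j → ∃ λ i → f i ≡ x
injective-misses-one f f-injective = choose (Fin.any? λ j → Fin.all? λ i → ¬? (f i Fin.≟ j))
  where
    hit-or-missed : ∀ x → (∃ λ i → f i ≡ x) ⊎ (∀ i → f i ≢ x)
    hit-or-missed x with Fin.any? (λ i → f i Fin.≟ x)
    ... | yes hit    = inj₁ hit
    ... | no  no-hit = inj₂ λ i fi≡x → no-hit (i , fi≡x)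
    choose : Dec (∃ λ j → ∀ i → f i ≢ j) → ∃ λ j → ∀ x → x ≢ j → ∃ λ i → f i ≡ x
    choose (no none-missed) = zero , λ x _ →
      fromInj₁ (λ x-missed → ⊥-elim (none-missed (x , x-missed))) (hit-or-missed x)
    choose (yes (j , j-missed)) = j , λ x x≢j →
      fromInj₁ (λ x-missed → ⊥-elim (injective-misses-two f-injective x≢j x-missed j-missed))
               (hit-or-missed x)

module _ {n : ℕ} where

  Walk-map : ∀ {P Q : Pred (Fin n) 0ℓ} → (∀ {k} → P k → Q k) → ∀ {i j} → Walk P i j → Walk Q i j
  Walk-map f (here p)     = here (f p)
  Walk-map f (step p a w) = step (f p) a (Walk-map f w)

  _◅◅_ : ∀ {P : Pred (Fin n) 0ℓ} {i j k} → Walk P i j → Walk P j k → Walk P i k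
  here _     ◅◅ w′ = w′
  step p a w ◅◅ w′ = step p a (w ◅◅ w′)

  walk-head : ∀ {P : Pred (Fin n) 0ℓ} {i j} → Walk P i j → P i
  walk-head (here p)     = p
  walk-head (step p _ _) = p

  Adj-sym : ∀ {i j : Fin n} → Adj n i j → Adj n j i
  Adj-sym (inj₁ p)               = inj₂ (inj₁ p)
  Adj-sym (inj₂ (inj₁ p))        = inj₁ p
  Adj-sym (inj₂ (inj₂ (inj₁ p))) = inj₂ (inj₂ (inj₂ p))
  Adj-sym (inj₂ (inj₂ (inj₂ p))) = inj₂ (inj₂ (inj₁ p))

  _~[_]_ : Fin n → CnConnectedPartition n → Fin n → Set
  x ~[ X ] y = T (same X x y)

  ~-refl : ∀ X {x} → x ~[ X ] x
  ~-refl X = same-refl X _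

  ~-sym : ∀ X {x y} → x ~[ X ] y → y ~[ X ] x
  ~-sym X = same-sym X _ _

  ~-trans : ∀ X {x y z} → x ~[ X ] y → y ~[ X ] z → x ~[ X ] z
  ~-trans X = same-trans X _ _ _

  partitionOf : (R : Rel (Fin n) 0ℓ) → Decidable R → IsEquivalence R →
                (∀ {i j} → R i j → Walk (R i) i j) → CnConnectedPartition n
  partitionOf R R? R-equivalence R-connected = record
    { same       = λ i j → ⌊ R? i j ⌋
    ; same-refl  = λ _ → fromWitness R.refl
    ; same-sym   = λ _ _ p → fromWitness (R.sym (toWitness p))
    ; same-trans = λ _ _ _ p q → fromWitness (R.trans (toWitness p) (toWitness q))
    ; connected  = λ _ _ p → Walk-map fromWitness (R-connected (toWitness p))
    }
    where module R = IsEquivalence R-equivalence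

  open Poset (BondLatticeCycle n) using (_≤_; _≈_; antisym)
  open PosetProperties (BondLatticeCycle n) using (_<_)

  discrete : CnConnectedPartition n
  discrete = partitionOf _≡_ Fin._≟_ ≡.isEquivalence λ { refl → here refl }

  discrete-least : ∀ X → discrete ≤ X
  discrete-least X i j i≡j = ≡.subst (i ~[ X ]_) (toWitness i≡j) (~-refl X)

  module JoinEdge (X : CnConnectedPartition n) {u v : Fin n} (uv : Adj n u v) where

    Touches : Fin n → Set
    Touches x = x ~[ X ] u ⊎ x ~[ X ] v

    touches-resp : ∀ {x y} → x ~[ X ] y → Touches y → Touches x
    touches-resp x~y (inj₁ y~u) = inj₁ (~-trans X x~y y~u)
    touches-resp x~y (inj₂ y~v) = inj₂ (~-trans X x~y y~v)

    -- No transitive closure is needed: only the (at most two) blocks touching u or v merge.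
    Joined : Rel (Fin n) 0ℓ
    Joined x y = x ~[ X ] y ⊎ (Touches x × Touches y)

    joined? : Decidable Joined
    joined? x y = T? _ ⊎-dec ((T? _ ⊎-dec T? _) ×-dec (T? _ ⊎-dec T? _))

    joined-equivalence : IsEquivalence Joined
    joined-equivalence = record { refl = inj₁ (~-refl X) ; sym = sym ; trans = trans }
      where
        sym : ∀ {x y} → Joined x y → Joined y x
        sym (inj₁ x~y)       = inj₁ (~-sym X x~y)
        sym (inj₂ (tx , ty)) = inj₂ (ty , tx)
        trans : ∀ {x y z} → Joined x y → Joined y z → Joined x z
        trans (inj₁ x~y)       (inj₁ y~z)       = inj₁ (~-trans X x~y y~z)
        trans (inj₁ x~y)       (inj₂ (ty , tz)) = inj₂ (touches-resp x~y ty , tz)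
        trans (inj₂ (tx , ty)) (inj₁ y~z)       = inj₂ (tx , touches-resp (~-sym X y~z) ty)
        trans (inj₂ (tx , _))  (inj₂ (_ , tz))  = inj₂ (tx , tz)

    joined-connected : ∀ {x y} → Joined x y → Walk (Joined x) x y
    joined-connected {x} {y} (inj₁ x~y)       = Walk-map inj₁ (connected X x y x~y)
    joined-connected {x} {y} (inj₂ (tx , ty)) = to-u tx ◅◅ from-u ty
      where
        touching : ∀ {k} → Touches k → Joined x k
        touching tk = inj₂ (tx , tk)
        to-u : Touches x → Walk (Joined x) x u
        to-u (inj₁ x~u) = Walk-map inj₁ (connected X x u x~u)
        to-u (inj₂ x~v) = Walk-map inj₁ (connected X x v x~v)
                          ◅◅ step (touching (inj₂ (~-refl X))) (Adj-sym uv)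
                                  (here (touching (inj₁ (~-refl X))))
        from-u : Touches y → Walk (Joined x) u y
        from-u (inj₁ y~u) = Walk-map (λ u~k → touching (inj₁ (~-sym X u~k))) (connected X u y (~-sym X y~u))
        from-u (inj₂ y~v) = step (touching (inj₁ (~-refl X))) uv
                              (Walk-map (λ v~k → touching (inj₂ (~-sym X v~k)))
                                        (connected X v y (~-sym X y~v)))

    join-edge : CnConnectedPartition n
    join-edge = partitionOf Joined joined? joined-equivalence joined-connected

    join-edge-joins : u ~[ join-edge ] v
    join-edge-joins = fromWitness (inj₂ (inj₁ (~-refl X) , inj₂ (~-refl X)))

    join-edge-least : ∀ {Z} → X ≤ Z → u ~[ Z ] v → join-edge ≤ Z
    join-edge-least {Z} X≤Z u~v x y x~y with toWitness x~y
    ... | inj₁ x~y                   = X≤Z x y x~y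
    ... | inj₂ (inj₁ x~u , inj₁ y~u) = X≤Z x y (~-trans X x~u (~-sym X y~u))
    ... | inj₂ (inj₂ x~v , inj₂ y~v) = X≤Z x y (~-trans X x~v (~-sym X y~v))
    ... | inj₂ (inj₁ x~u , inj₂ y~v) =
      ~-trans Z (X≤Z x u x~u) (~-trans Z u~v (X≤Z v y (~-sym X y~v)))
    ... | inj₂ (inj₂ x~v , inj₁ y~u) =
      ~-trans Z (X≤Z x v x~v) (~-trans Z (~-sym Z u~v) (X≤Z u y (~-sym X y~u)))

    join-edge-⋖ : ¬ u ~[ X ] v → X ⋖[ BondLatticeCycle n ] join-edge
    join-edge-⋖ u≁v = (X≤J , X≉J) , λ Z (X<Z , Z<J) → nothing-between Z X<Z Z<J (T? (same Z u v))
      where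
        X≤J : X ≤ join-edge
        X≤J _ _ = fromWitness ∘ inj₁
        X≉J : ¬ X ≈ join-edge
        X≉J X≈J = u≁v (≡.subst T (≡.sym (X≈J u v)) join-edge-joins)
        unjoined⇒≤X : ∀ {Z} → Z ≤ join-edge → ¬ u ~[ Z ] v → X ≤ Z → Z ≤ X
        unjoined⇒≤X {Z} Z≤J u≁Zv X≤Z x y x~Zy with toWitness (Z≤J x y x~Zy)
        ... | inj₁ x~y                   = x~y
        ... | inj₂ (inj₁ x~u , inj₁ y~u) = ~-trans X x~u (~-sym X y~u)
        ... | inj₂ (inj₂ x~v , inj₂ y~v) = ~-trans X x~v (~-sym X y~v)
        ... | inj₂ (inj₁ x~u , inj₂ y~v) =
          ⊥-elim (u≁Zv (~-trans Z (X≤Z u x (~-sym X x~u)) (~-trans Z x~Zy (X≤Z y v y~v))))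
        ... | inj₂ (inj₂ x~v , inj₁ y~u) =
          ⊥-elim (u≁Zv (~-trans Z (X≤Z u y (~-sym X y~u)) (~-trans Z (~-sym Z x~Zy) (X≤Z x v x~v))))
        nothing-between : ∀ Z → X < Z → Z < join-edge → Dec (u ~[ Z ] v) → ⊥
        nothing-between Z (X≤Z , _) (Z≤J , Z≉J) (yes u~Zv) =
          Z≉J (antisym {Z} {join-edge} Z≤J (join-edge-least {Z} X≤Z u~Zv))
        nothing-between Z (X≤Z , X≉Z) (Z≤J , _) (no u≁Zv) =
          X≉Z (antisym {X} {Z} X≤Z (unjoined⇒≤X {Z} Z≤J u≁Zv X≤Z))

module _ {m : ℕ} where

  next : Fin (suc m) → Fin (suc m)
  next x = next-of (view x)
    where
      next-of : ∀ {x : Fin (suc m)} → View x → Fin (suc m)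
      next-of ‵fromℕ       = zero
      next-of (‵inject₁ i) = suc i

  next-fromℕ : next (fromℕ m) ≡ zero
  next-fromℕ rewrite view-fromℕ m = refl

  next-inject₁ : ∀ i → next (inject₁ i) ≡ suc i
  next-inject₁ i rewrite view-inject₁ i = refl

  Adj-next : ∀ x → Adj (suc m) x (next x)
  Adj-next x with view x
  ... | ‵fromℕ     = inj₂ (inj₂ (inj₂ (refl , ≡.cong suc (Fin.toℕ-fromℕ m))))
  ... | ‵inject₁ i = inj₁ (≡.cong suc (Fin.toℕ-inject₁ i))

  succ⇒next : ∀ {x y : Fin (suc m)} →
              suc (toℕ x) ≡ toℕ y ⊎ (toℕ y ≡ 0 × suc (toℕ x) ≡ suc m) → y ≡ next x
  succ⇒next {x} {y} x→y with view x | x→y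
  ... | ‵fromℕ     | inj₁ x+1≡y = ⊥-elim (ℕ.1+n≰n (≡.subst (ℕ._≤ m)
          (≡.sym (≡.trans (≡.cong suc (≡.sym (Fin.toℕ-fromℕ m))) x+1≡y)) (Fin.toℕ≤pred[n] y)))
  ... | ‵fromℕ     | inj₂ (y≡0 , _) = Fin.toℕ-injective y≡0
  ... | ‵inject₁ i | inj₁ x+1≡y =
    Fin.toℕ-injective (≡.trans (≡.sym x+1≡y) (≡.cong suc (Fin.toℕ-inject₁ i)))
  ... | ‵inject₁ i | inj₂ (_ , x+1≡m+1) =
    ⊥-elim (Fin.toℕ-inject₁-≢ i (≡.sym (ℕ.suc-injective x+1≡m+1)))

  Adj⇒next : ∀ {x y} → Adj (suc m) x y → y ≡ next x ⊎ x ≡ next y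
  Adj⇒next (inj₁ x→y)               = inj₁ (succ⇒next (inj₁ x→y))
  Adj⇒next (inj₂ (inj₁ y→x))        = inj₂ (succ⇒next (inj₁ y→x))
  Adj⇒next (inj₂ (inj₂ (inj₁ y→x))) = inj₂ (succ⇒next (inj₂ y→x))
  Adj⇒next (inj₂ (inj₂ (inj₂ x→y))) = inj₁ (succ⇒next (inj₂ x→y))

  all-but-one-edge : ∀ W (j : Fin (suc m)) → (∀ x → x ≢ j → x ~[ W ] next x) → ∀ x y → x ~[ W ] y
  all-but-one-edge W j edge x y = ~-trans W (~-sym W (zero~ x)) (zero~ y)
    where
      path-step : ∀ i → inject₁ i ≢ j → inject₁ i ~[ W ] suc i
      path-step i i≢j = ≡.subst (inject₁ i ~[ W ]_) (next-inject₁ i) (edge (inject₁ i) i≢j)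
      up : ∀ i → (inject₁ i Fin.≤ j → zero ~[ W ] inject₁ i) → suc i Fin.≤ j → zero ~[ W ] suc i
      up i ih i<j = ~-trans W (ih (ℕ.<⇒≤ i′<j)) (path-step i (Fin.<⇒≢ i′<j))
        where
          i′<j : inject₁ i Fin.< j
          i′<j = ≡.subst (λ a → suc a ℕ.≤ toℕ j) (≡.sym (Fin.toℕ-inject₁ i)) i<j
      top : j Fin.< fromℕ m → fromℕ m ~[ W ] zero
      top j<top = ≡.subst (fromℕ m ~[ W ]_) next-fromℕ (edge (fromℕ m) (Fin.<⇒≢ j<top ∘ ≡.sym))
      down : ∀ i → (j Fin.< suc i → suc i ~[ W ] zero) → j Fin.< inject₁ i → inject₁ i ~[ W ] zero
      down i ih j<i′ = ~-trans W (path-step i (Fin.<⇒≢ j<i′ ∘ ≡.sym)) (ih (ℕ.m<n⇒m<1+n j<i))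
        where
          j<i : j Fin.< i
          j<i = ≡.subst (toℕ j ℕ.<_) (Fin.toℕ-inject₁ i) j<i′
      zero~ : ∀ x → zero ~[ W ] x
      zero~ x with x Fin.≤? j
      ... | yes x≤j = <-weakInduction (λ x → x Fin.≤ j → zero ~[ W ] x) (λ _ → ~-refl W) up x x≤j
      ... | no  x≰j = ~-sym W (>-weakInduction (λ x → j Fin.< x → x ~[ W ] zero) top down x (ℕ.≰⇒> x≰j))

module _ {m : ℕ} where
  open Poset (BondLatticeCycle (suc (suc m))) using (_≤_; _≈_; antisym; module Eq)

  Adj-irreflexive : ∀ {x} → ¬ Adj (suc (suc m)) x x
  Adj-irreflexive (inj₁ x+1≡x)                       = ℕ.1+n≢n x+1≡x
  Adj-irreflexive (inj₂ (inj₁ x+1≡x))                = ℕ.1+n≢n x+1≡x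
  Adj-irreflexive (inj₂ (inj₂ (inj₁ (x≡0 , x+1≡n)))) =
    ℕ.0≢1+n (≡.trans (≡.sym x≡0) (ℕ.suc-injective x+1≡n))
  Adj-irreflexive (inj₂ (inj₂ (inj₂ (x≡0 , x+1≡n)))) =
    ℕ.0≢1+n (≡.trans (≡.sym x≡0) (ℕ.suc-injective x+1≡n))

  discrete⋖edge : ∀ x → discrete ⋖[ BondLatticeCycle (suc (suc m)) ] JoinEdge.join-edge discrete (Adj-next x)
  discrete⋖edge x = JoinEdge.join-edge-⋖ discrete (Adj-next x) λ x~next →
    Adj-irreflexive (≡.subst (Adj _ x) (≡.sym (toWitness x~next)) (Adj-next x))

  edge-free⇒≤discrete : ∀ X → (∀ x → ¬ x ~[ X ] next x) → X ≤ discrete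
  edge-free⇒≤discrete X no-edge x y x~y = fromWitness (walk-stays (connected X x y x~y))
    where
      walk-stays : ∀ {y} → Walk (x ~[ X ]_) x y → x ≡ y
      walk-stays (here _)       = refl
      walk-stays (step _ x-j w) with Adj⇒next x-j
      ... | inj₁ j≡next-x = ⊥-elim (no-edge x (≡.subst (x ~[ X ]_) j≡next-x (walk-head w)))
      ... | inj₂ x≡next-j = ⊥-elim (no-edge _ (≡.subst (_ ~[ X ]_) x≡next-j (~-sym X (walk-head w))))

  _≈?_ : Decidable _≈_
  X ≈? Y = Fin.all? λ i → Fin.all? λ j → same X i j Bool.≟ same Y i j

  atom-edge : ∀ C → discrete ⋖[ BondLatticeCycle (suc (suc m)) ] C → ∃ λ x → x ~[ C ] next x
  atom-edge C ((_ , discrete≉C) , _) with Fin.any? (λ x → T? (same C x (next x)))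
  ... | yes edge   = edge
  ... | no no-edge = ⊥-elim (discrete≉C (antisym {discrete} {C} (discrete-least C)
                       (edge-free⇒≤discrete C λ x x~next → no-edge (x , x~next))))

  atom≈edge : ∀ C {x} → discrete ⋖[ BondLatticeCycle (suc (suc m)) ] C → x ~[ C ] next x →
              C ≈ JoinEdge.join-edge discrete (Adj-next x)
  atom≈edge C {x} (_ , nothing-between) x~next =
    Eq.sym {J} {C} (decidable-stable (J ≈? C) λ J≉C →
      nothing-between J (proj₁ (discrete⋖edge x) , J≤C , J≉C))
    where
      J = JoinEdge.join-edge discrete (Adj-next x)
      J≤C : J ≤ C
      J≤C = JoinEdge.join-edge-least discrete (Adj-next x) {C} (discrete-least C) x~next

  atoms-force-top : AtomsForceTop (BondLatticeCycle (suc (suc m))) (Fin (suc m)) discrete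
  atoms-force-top C C-atom C-injective {W} C≤W _ x y _ = all-but-one-edge W j present x y
    where
      edge : Fin (suc m) → Fin (suc (suc m))
      edge i = proj₁ (atom-edge (C i) (C-atom i))
      edge-in : ∀ i → edge i ~[ C i ] next (edge i)
      edge-in i = proj₂ (atom-edge (C i) (C-atom i))
      edge-injective : Injective _≡_ _≡_ edge
      edge-injective {i} {i′} eq = C-injective (Eq.trans {C i} {J} {C i′}
        (atom≈edge (C i) (C-atom i) (edge-in i))
        (Eq.sym {C i′} {J} (atom≈edge (C i′) (C-atom i′)
          (≡.subst (λ x → x ~[ C i′ ] next x) (≡.sym eq) (edge-in i′)))))
        where J = JoinEdge.join-edge discrete (Adj-next (edge i))
      j : Fin (suc (suc m))
      j = proj₁ (injective-misses-one edge edge-injective)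
      present : ∀ x → x ≢ j → x ~[ W ] next x
      present x x≢j =
        ≡.subst (λ z → z ~[ W ] next z) (proj₂ hit) (C≤W (proj₁ hit) _ _ (edge-in (proj₁ hit)))
        where
          hit : ∃ λ i → edge i ≡ x
          hit = proj₂ (injective-misses-one edge edge-injective) x x≢j

module _ {k : ℕ} where
  private
    m : ℕ
    m = 3 ℕ.+ k
  open Poset (BondLatticeCycle (suc m)) using (_≤_; _≈_)

  closing-edge : Adj (suc m) (fromℕ m) zero
  closing-edge = inj₂ (inj₂ (inj₂ (refl , ≡.cong suc (Fin.toℕ-fromℕ m))))

  path-edge : ∀ i → Adj (suc m) (inject₁ i) (suc i)
  path-edge i = inj₁ (≡.cong suc (Fin.toℕ-inject₁ i))

  closing-atom : CnConnectedPartition (suc m)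
  closing-atom = JoinEdge.join-edge discrete closing-edge

  closing∨path : Fin m → CnConnectedPartition (suc m)
  closing∨path i = JoinEdge.join-edge closing-atom (path-edge i)

  OnClosingEdge : ℕ → Set
  OnClosingEdge a = a ≡ m ⊎ a ≡ 0

  _≈ᶜ_ : ℕ → ℕ → Set
  a ≈ᶜ b = a ≡ b ⊎ (OnClosingEdge a × OnClosingEdge b)

  closing-related : ∀ {x y} → x ~[ closing-atom ] y → toℕ x ≈ᶜ toℕ y
  closing-related x~y with toWitness x~y
  ... | inj₁ x≡y             = inj₁ (≡.cong toℕ (toWitness x≡y))
  ... | inj₂ (x-end , y-end) = inj₂ (end x-end , end y-end)
    where
      end : ∀ {z} → z ~[ discrete ] fromℕ m ⊎ z ~[ discrete ] zero → OnClosingEdge (toℕ z)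
      end (inj₁ z≡top)  = inj₁ (≡.trans (≡.cong toℕ (toWitness z≡top)) (Fin.toℕ-fromℕ m))
      end (inj₂ z≡zero) = inj₂ (≡.cong toℕ (toWitness z≡zero))

  closing-related-path : ∀ {i y} → inject₁ i ~[ closing-atom ] y → toℕ i ≈ᶜ toℕ y
  closing-related-path {i} i~y = ≡.subst (_≈ᶜ _) (Fin.toℕ-inject₁ i) (closing-related i~y)

  ≈ᶜ-below : ∀ {a b} → a ℕ.< m → b ℕ.< m → a ≈ᶜ b → a ≡ b
  ≈ᶜ-below _   _   (inj₁ a≡b)                   = a≡b
  ≈ᶜ-below a<m _   (inj₂ (inj₁ a≡m , _))        = ⊥-elim (ℕ.<⇒≢ a<m a≡m)
  ≈ᶜ-below _   b<m (inj₂ (_ , inj₁ b≡m))        = ⊥-elim (ℕ.<⇒≢ b<m b≡m)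
  ≈ᶜ-below _   _   (inj₂ (inj₂ a≡0 , inj₂ b≡0)) = ≡.trans a≡0 (≡.sym b≡0)

  ≈ᶜ-suc : ∀ {a b} → suc a ≈ᶜ suc b → a ≡ b
  ≈ᶜ-suc (inj₁ a+1≡b+1)                   = ℕ.suc-injective a+1≡b+1
  ≈ᶜ-suc (inj₂ (inj₁ a+1≡m , inj₁ b+1≡m)) = ℕ.suc-injective (≡.trans a+1≡m (≡.sym b+1≡m))
  ≈ᶜ-suc (inj₂ (inj₂ () , _))
  ≈ᶜ-suc (inj₂ (_ , inj₂ ()))

  ≉ᶜ-suc : ∀ {a} → a ℕ.< m → ¬ a ≈ᶜ suc a
  ≉ᶜ-suc _   (inj₁ a≡a+1)          = ℕ.1+n≢n (≡.sym a≡a+1)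
  ≉ᶜ-suc a<m (inj₂ (inj₁ a≡m , _)) = ℕ.<⇒≢ a<m a≡m
  ≉ᶜ-suc _   (inj₂ (inj₂ refl , inj₁ ()))
  ≉ᶜ-suc _   (inj₂ (_ , inj₂ ()))

  -- The only place where n ≥ 4 is needed: in C_3 the two path edges meeting the closing edge
  -- would give the same cover.
  ≈ᶜ-crossed : ∀ {a b} → a ℕ.< m → b ℕ.< m → a ≈ᶜ suc b → ¬ suc a ≈ᶜ b
  ≈ᶜ-crossed a<m _   (inj₂ (inj₁ a≡m , _)) _ = ℕ.<⇒≢ a<m a≡m
  ≈ᶜ-crossed _   b<m _ (inj₂ (_ , inj₁ b≡m)) = ℕ.<⇒≢ b<m b≡m
  ≈ᶜ-crossed _   _   (inj₂ (_ , inj₂ ())) _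
  ≈ᶜ-crossed _   _   _ (inj₂ (inj₂ () , _))
  ≈ᶜ-crossed _   _   (inj₁ refl) (inj₁ b+2≡b)  = ℕ.m+1+n≢n 1 b+2≡b
  ≈ᶜ-crossed _   _   (inj₁ refl) (inj₂ (inj₁ () , inj₂ refl))
  ≈ᶜ-crossed _   _   (inj₂ (inj₂ refl , inj₁ ())) (inj₁ refl)
  ≈ᶜ-crossed _   _   (inj₂ (inj₂ refl , _)) (inj₂ (inj₁ () , _))

  closing-atom≰discrete : ¬ closing-atom ≤ discrete
  closing-atom≰discrete closing≤discrete =
    closing≤discrete (fromℕ m) zero (JoinEdge.join-edge-joins discrete closing-edge)

  closing-atom⋖closing∨path : ∀ i → closing-atom ⋖[ BondLatticeCycle (suc m) ] closing∨path i
  closing-atom⋖closing∨path i = JoinEdge.join-edge-⋖ closing-atom (path-edge i) λ i~i+1 →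
    ≉ᶜ-suc (Fin.toℕ<n i) (closing-related-path i~i+1)

  closing∨path-injective : Injective _≡_ _≈_ closing∨path
  closing∨path-injective {i} {j} covers≈
    with toWitness (≡.subst T (covers≈ (inject₁ i) (suc i))
                            (JoinEdge.join-edge-joins closing-atom (path-edge i)))
  ... | inj₁ i~i+1 = ⊥-elim (≉ᶜ-suc (Fin.toℕ<n i) (closing-related-path i~i+1))
  ... | inj₂ (inj₁ i~j , _) = Fin.toℕ-injective (≈ᶜ-below (Fin.toℕ<n i) (Fin.toℕ<n j)
          (≡.subst (_ ≈ᶜ_) (Fin.toℕ-inject₁ j) (closing-related-path i~j)))
  ... | inj₂ (_ , inj₂ i+1~j+1) = Fin.toℕ-injective (≈ᶜ-suc (closing-related i+1~j+1))
  ... | inj₂ (inj₂ i~j+1 , inj₁ i+1~j) = ⊥-elim (≈ᶜ-crossed (Fin.toℕ<n i) (Fin.toℕ<n j)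
          (closing-related-path i~j+1) (≡.subst (_ ≈ᶜ_) (Fin.toℕ-inject₁ j) (closing-related i+1~j)))

open import Data.Nat using (_≤_)

corollary5p15 : ∀ {c ℓ₁ ℓ₂} (n : ℕ) → 4 ≤ n → (U : UphoLattice c ℓ₁ ℓ₂) →
    (t : Lattice.Carrier (UphoLattice.lattice U)) → UphoLattice.IsJoinOfAtoms U t →
      ¬ OrderIso (BondLatticeCycle n) (UphoLattice.Core U t)
corollary5p15 _ (s≤s (s≤s (s≤s (s≤s _)))) U t (atoms≤t , _) ψ =
  core-has-no-forcing-covers U atoms≤t ψ discrete discrete-least closing-atom closing-atom≰discrete
    closing∨path closing-atom⋖closing∨path closing∨path-injective atoms-force-top
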